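{- Let $0<e_0\le1$ and $1\le m_1\le m-1$. Consider an instance of $P_m, e_{i\le m_1,k}\ge e_0\mid\mid C_{\max}$ with optimal makespan $C^*_{\max}$, and let $S$ be a schedule produced by LS-ECT (for some job list). For $1\le i\le m$ let $f_i$ be the completion time of the last job on machine $M_i$ in $S$, and let $X$ be the number of jobs that are scheduled on machines $M_1,\dots,M_{m_1}$ in $S$ and complete after $C^*_{\max}$. If $f_i>C^*_{\max}$ for all $1\le i\le m_1$, then $X\le m-1$.
   Context: Shared-processing scheduling model: $m$ identical parallel machines $M_1,\dots,M_m$; $n$ primary jobs available at time $0$, job $j$ with processing time $p_j>0$, each processed without interruption on one machine. The time axis of each $M_i$ is partitioned into consecutive intervals $(0,t_{i,1}],(t_{i,1},t_{i,2}],\dots$ with sharing ratios $e_{i,1},e_{i,2},\dots\in(0,1]$; during an interval with ratio $e$ a primary job on that machine receives $e$ units of processing per unit of time. Jobs on a machine are processed consecutively; a job with processing time $p$ started at time $s$ on $M_i$ completes at the earliest $C$ with $\int_s^C e_i(t)dt=p$. Makespan $C_{\max}=\max_j C_j$. The problem $P_m, e_{i\le m_1,k}\ge e_0\mid\mid C_{\max}$ is makespan minimization where all sharing ratios on machines $M_1,\dots,M_{m_1}$ are at least $e_0$, while sharing ratios on $M_{m_1+1},\dots,M_m$ are arbitrary in $(0,1]$. LS-ECT (List Scheduling – Earliest Completion Time): given an ordered list of the jobs, the jobs are taken one by one in list order and each is appended at the end of the machine on which it would complete earliest (given the jobs already scheduled).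
   Formalization: The processing times $p_j$, the interval endpoints and sharing ratios of every machine, and the bound $e_0$ are rational. -}

module Defs where

open import Data.Nat as ℕ using (ℕ; zero; suc)
open import Data.Fin using (Fin; toℕ; _≟_)
open import Data.List using (List; []; _∷_; _++_; [_]; map; concat; filter; length; foldr)
open import Data.Nat.ListAction using (sum)
open import Data.List.Base using (allFin)
open import Data.List.Relation.Binary.Permutation.Propositional using (_↭_)
open import Data.Product using (Σ; ∃; _×_; _,_)
open import Data.Bool using (if_then_else_)
open import Relation.Nullary using (does; ¬_)
open import Relation.Binary.PropositionalEquality using (_≡_)
open import Data.Rational using (ℚ; 0ℚ; 1ℚ; _+_; _*_; _-_; _⊓_; _⊔_; _≤_; _<_)
open import Data.Rational.Properties using (_<?_)

-- Sharing profile of one machine: breakpoints 0 = t 0 < t 1 < t 2 < ... (unbounded),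
-- interval k is (t k , t (suc k)] and has sharing ratio e k ∈ (0,1].
record Profile : Set where
  field
    t         : ℕ → ℚ
    e         : ℕ → ℚ
    t-zero    : t 0 ≡ 0ℚ
    t-incr    : ∀ k → t k < t (suc k)
    t-unbdd   : ∀ q → ∃ λ k → q ≤ t k
    e-pos     : ∀ k → 0ℚ < e k
    e-le1     : ∀ k → e k ≤ 1ℚ
open Profile public

-- Σ_{k<N} e k * (x ⊓ t (k+1) - x ⊓ t k) : the integral of e over (0 , x ⊓ t N].
partialWork : Profile → ℕ → ℚ → ℚ
partialWork P zero    x = 0ℚ
partialWork P (suc N) x = partialWork P N x + e P N * ((x ⊓ t P (suc N)) - (x ⊓ t P N))

Work : Profile → ℚ → ℚ → Set
Work P x w = ∃ λ N → x ≤ t P N × partialWork P N x ≡ w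

Completes : Profile → ℚ → ℚ → ℚ → Set
Completes P s p C =
  Σ ℚ λ ws → Σ ℚ λ wc →
    Work P s ws × Work P C wc × wc ≡ ws + p × s ≤ C ×
    (∀ C' w' → s ≤ C' → C' < C → Work P C' w' → ¬ (w' ≡ ws + p))

data Run (P : Profile) {n : ℕ} (p : Fin n → ℚ) : ℚ → List (Fin n) → List ℚ → Set where
  run-[] : ∀ {s} → Run P p s [] []
  run-∷  : ∀ {s j js C Cs} → Completes P s (p j) C → Run P p C js Cs → Run P p s (j ∷ js) (C ∷ Cs)

lastOr : ℚ → List ℚ → ℚ
lastOr d []       = d
lastOr d (x ∷ xs) = lastOr x xs

finish : ∀ {m} → (Fin m → List ℚ) → Fin m → ℚ
finish Cs i = lastOr 0ℚ (Cs i)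

makespan : ∀ {m} → (Fin m → List ℚ) → ℚ
makespan {m} Cs = foldr _⊔_ 0ℚ (map (finish Cs) (allFin m))

Feasible : ∀ {m n} → (Fin m → Profile) → (Fin n → ℚ) →
           (Fin m → List (Fin n)) → (Fin m → List ℚ) → Set
Feasible {m} {n} prof p S Cs =
  concat (map S (allFin m)) ↭ allFin n × (∀ i → Run (prof i) p 0ℚ (S i) (Cs i))

IsOptimalMakespan : ∀ {m n} → (Fin m → Profile) → (Fin n → ℚ) → ℚ → Set
IsOptimalMakespan {m} {n} prof p Cstar =
  (Σ (Fin m → List (Fin n)) λ S → Σ (Fin m → List ℚ) λ Cs →
      Feasible prof p S Cs × makespan Cs ≡ Cstar)
  × (∀ S Cs → Feasible prof p S Cs → Cstar ≤ makespan Cs)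

update : ∀ {m} {A : Set} → (Fin m → A) → Fin m → (A → A) → Fin m → A
update f i g k = if does (k ≟ i) then g (f k) else f k

data LSECT {m n : ℕ} (prof : Fin m → Profile) (p : Fin n → ℚ) :
     (Fin m → List (Fin n)) → (Fin m → List ℚ) → List (Fin n) →
     (Fin m → List (Fin n)) → (Fin m → List ℚ) → Set where
  ls-done : ∀ {S Cs} → LSECT prof p S Cs [] S Cs
  ls-step : ∀ {S Cs j L S' Cs'} (i : Fin m) (C : ℚ) →
            Completes (prof i) (finish Cs i) (p j) C →
            (∀ i' C' → Completes (prof i') (finish Cs i') (p j) C' → C ≤ C') →
            LSECT prof p (update S i (λ js → js ++ [ j ])) (update Cs i (λ cs → cs ++ [ C ])) L S' Cs' →
            LSECT prof p S Cs (j ∷ L) S' Cs'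

LSECTSchedule : ∀ {m n} → (Fin m → Profile) → (Fin n → ℚ) →
                (Fin m → List (Fin n)) → (Fin m → List ℚ) → Set
LSECTSchedule {m} {n} prof p S Cs =
  Σ (List (Fin n)) λ L → L ↭ allFin n × LSECT prof p (λ _ → []) (λ _ → []) L S Cs

-- number of jobs on machines M_1..M_{m1} (indices toℕ i < m1) completing after Cstar
lateCount : ∀ {m} → ℕ → ℚ → (Fin m → List ℚ) → ℕ
lateCount {m} m1 Cstar Cs =
  sum (map (λ i → if does (toℕ i ℕ.<? m1) then length (filter (λ c → Cstar <? c) (Cs i)) else 0)
           (allFin m))

-- Write W k x for the work machine k can do in (0, x].  Along the LS-ECT run we keep some
-- q > 0 such that every machine k satisfies W k C* + r_k q < W k f_k + q, where r_k counts
-- its jobs completing after C*.  Once a job is late on machine k, each further late job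
-- there adds at least q of work after C*.  When a job j is placed late, the
-- earliest-completion rule shows that no machine could still do p_j units of work by C*,
-- so shrinking q to min q p_j keeps the inequality on every machine.  Summing over the
-- machines, the sum of W k f_k is the total processing time, which the optimal schedule fits
-- into the sum of W k C*; hence (the sum of r_k) q < m q.  This bounds the late jobs on all
-- machines.

{-# OPTIONS --safe #-}
module Submission where

open import Defs
open import Data.Nat using (ℕ; _∸_) renaming (_≤_ to _≤ℕ_; _<_ to _<ℕ_)
open import Data.Fin using (Fin; toℕ)
open import Data.List using (List)
open import Data.Rational using (ℚ; 0ℚ; 1ℚ; _≤_; _<_)

open import Data.Nat as ℕ using (zero; suc; z≤n; s≤s)
import Data.Nat.Properties as ℕ
open import Data.Nat.ListAction using () renaming (sum to sumℕ)
open import Data.Fin using (_≟_) renaming (zero to fzero; suc to fsuc)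
import Data.Fin.Properties as Fin
open import Data.List using ([]; _∷_; _++_; [_]; map; concat; filter; length; foldr; tabulate; allFin)
open import Data.List.Properties using (map-tabulate; length-++; filter-++; filter-accept; filter-reject)
open import Data.List.Relation.Binary.Permutation.Propositional using (_↭_; ↭⇒↭ₛ)
open import Data.List.Relation.Binary.Permutation.Propositional.Properties using (map⁺)
open import Data.List.Relation.Binary.Permutation.Setoid.Properties using (foldr-commMonoid)
open import Data.Vec.Functional using (Vector; replicate)
open import Data.Rational using (_+_; _*_; _-_; -_; _⊓_; _⊔_; 1/_; Positive; NonZero; positive; nonNegative)
open import Data.Rational.Properties hiding (_≟_)
open import Data.Rational.Solver using (module +-*-Solver)
open import Algebra.Bundles using (CommutativeMonoid)
open import Algebra.Properties.CommutativeMonoid.Sum +-0-commutativeMonoid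
  using (sum; sum-cong-≗; ∑-distrib-+; sum-replicate; sum-replicate-zero)
open import Algebra.Properties.CommutativeSemigroup (CommutativeMonoid.commutativeSemigroup +-0-commutativeMonoid)
  using (x∙yz≈xz∙y; xy∙z≈xz∙y)
open import Algebra.Properties.Monoid.Mult +-0-monoid using (×-homo-+) renaming (_×_ to _·_)
import Algebra.Properties.Monoid.Sum ℕ.+-0-monoid as ℕΣ
open import Data.Product using (Σ; _×_; _,_; proj₁; proj₂)
open import Data.Sum using (inj₁; inj₂)
open import Data.Bool using (true; false; if_then_else_)
open import Function using (_∘_; id)
open import Relation.Binary.Definitions using (tri<; tri≈; tri>)
open import Relation.Binary.PropositionalEquality hiding ([_])
open import Relation.Nullary using (yes; no; does; ¬_; contradiction)

open +-*-Solver

strictMono⇒mono : ∀ {f : ℚ → ℚ} {x y} → (x < y → f x < f y) → x ≤ y → f x ≤ f y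
strictMono⇒mono {x = x} {y} strict x≤y with <-cmp x y
... | tri< x<y _ _ = <⇒≤ (strict x<y)
... | tri≈ _ refl _ = ≤-refl
... | tri> _ _ y<x = contradiction (≤-<-trans x≤y y<x) (<-irrefl refl)

p≤p+q : ∀ p {q} → 0ℚ ≤ q → p ≤ p + q
p≤p+q p 0≤q = subst (_≤ p + _) (+-identityʳ p) (+-monoʳ-≤ p 0≤q)

p<p+q : ∀ p {q} → 0ℚ < q → p < p + q
p<p+q p 0<q = subst (_< p + _) (+-identityʳ p) (+-monoʳ-< p 0<q)

+-cancelʳ-< : ∀ {x y} z → x + z < y + z → x < y
+-cancelʳ-< {x} {y} z = subst₂ _<_ (cancel x z) (cancel y z) ∘ +-monoˡ-< (- z)
  where
  cancel : ∀ u v → (u + v) - v ≡ u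
  cancel = solve 2 (λ u v → (u :+ v) :- v := u) refl

<-⊓ : ∀ {a x y} → a < x → a < y → a < x ⊓ y
<-⊓ {x = x} {y} a<x a<y with ⊓-sel x y
... | inj₁ x⊓y≡x = subst (_ <_) (sym x⊓y≡x) a<x
... | inj₂ x⊓y≡y = subst (_ <_) (sym x⊓y≡y) a<y

affine-solve : ∀ {A w r a b} → 0ℚ < r → A ≤ w → w ≤ A + r * (b - a) →
               Σ ℚ λ C → a ≤ C × C ≤ b × A + r * (C - a) ≡ w
affine-solve {A} {w} {r} {a} {b} 0<r A≤w w≤A+r[b-a] = a + d , p≤p+q a 0≤d , a+d≤b , solves
  where
  instance
    r-positive : Positive r
    r-positive = positive 0<r
    r-nonZero : NonZero r
    r-nonZero = pos⇒nonZero r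
  open ≤-Reasoning
  d : ℚ
  d = (w - A) * 1/ r
  r*d≡w-A : r * d ≡ w - A
  r*d≡w-A = begin-equality
    r * ((w - A) * 1/ r)  ≡⟨ solve 3 (λ r u v → r :* (u :* v) := u :* (r :* v)) refl r (w - A) (1/ r) ⟩
    (w - A) * (r * 1/ r)  ≡⟨ cong ((w - A) *_) (*-inverseʳ r) ⟩
    (w - A) * 1ℚ          ≡⟨ *-identityʳ (w - A) ⟩
    w - A                 ∎
  0≤d : 0ℚ ≤ d
  0≤d = *-cancelˡ-≤-pos r (begin
    r * 0ℚ  ≡⟨ *-zeroʳ r ⟩
    0ℚ      ≡⟨ +-inverseʳ A ⟨
    A - A   ≤⟨ +-monoˡ-≤ (- A) A≤w ⟩
    w - A   ≡⟨ r*d≡w-A ⟨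
    r * d   ∎)
  d≤b-a : d ≤ b - a
  d≤b-a = *-cancelˡ-≤-pos r (begin
    r * d                      ≡⟨ r*d≡w-A ⟩
    w - A                      ≤⟨ +-monoˡ-≤ (- A) w≤A+r[b-a] ⟩
    (A + r * (b - a)) - A      ≡⟨ solve 2 (λ A x → (A :+ x) :- A := x) refl A (r * (b - a)) ⟩
    r * (b - a)                ∎)
  a+d≤b : a + d ≤ b
  a+d≤b = begin
    a + d        ≤⟨ +-monoʳ-≤ a d≤b-a ⟩
    a + (b - a)  ≡⟨ solve 2 (λ a b → a :+ (b :- a) := b) refl a b ⟩
    b            ∎
  solves : A + r * ((a + d) - a) ≡ w
  solves = begin-equality
    A + r * ((a + d) - a)  ≡⟨ cong (λ u → A + r * u) (solve 2 (λ a d → (a :+ d) :- a := d) refl a d) ⟩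
    A + r * d              ≡⟨ cong (A +_) r*d≡w-A ⟩
    A + (w - A)            ≡⟨ solve 2 (λ A w → A :+ (w :- A) := w) refl A w ⟩
    w                      ∎

·-nonneg : ∀ r {q} → 0ℚ ≤ q → 0ℚ ≤ r · q
·-nonneg zero    0≤q = ≤-refl
·-nonneg (suc r) 0≤q = +-mono-≤ 0≤q (·-nonneg r 0≤q)

·-monoˡ-≤ : ∀ {r s q} → 0ℚ ≤ q → r ≤ℕ s → r · q ≤ s · q
·-monoˡ-≤ {s = s} 0≤q z≤n       = ·-nonneg s 0≤q
·-monoˡ-≤ {q = q} 0≤q (s≤s r≤s) = +-monoʳ-≤ q (·-monoˡ-≤ 0≤q r≤s)

·-monoʳ-≤ : ∀ r {q q′} → q′ ≤ q → r · q′ ≤ r · q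
·-monoʳ-≤ zero    q′≤q = ≤-refl
·-monoʳ-≤ (suc r) q′≤q = +-mono-≤ q′≤q (·-monoʳ-≤ r q′≤q)

sum-mono-≤ : ∀ {m} {f g : Vector ℚ m} → (∀ i → f i ≤ g i) → sum f ≤ sum g
sum-mono-≤ {zero}  f≤g = ≤-refl
sum-mono-≤ {suc m} f≤g = +-mono-≤ (f≤g fzero) (sum-mono-≤ (f≤g ∘ fsuc))

sum-mono-< : ∀ {m} {f g : Vector ℚ (suc m)} → (∀ i → f i < g i) → sum f < sum g
sum-mono-< f<g = +-mono-<-≤ (f<g fzero) (sum-mono-≤ (<⇒≤ ∘ f<g ∘ fsuc))

sum-update : ∀ {m} {f g : Vector ℚ m} i d → (∀ k → k ≢ i → g k ≡ f k) → g i ≡ f i + d →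
             sum g ≡ sum f + d
sum-update {suc m} {f} {g} fzero d elsewhere here = begin
  g fzero + sum (g ∘ fsuc)       ≡⟨ cong₂ _+_ here (sum-cong-≗ (λ k → elsewhere (fsuc k) λ ())) ⟩
  (f fzero + d) + sum (f ∘ fsuc) ≡⟨ xy∙z≈xz∙y (f fzero) d _ ⟩
  sum f + d                      ∎
  where open ≡-Reasoning
sum-update {suc m} {f} {g} (fsuc i) d elsewhere here = begin
  g fzero + sum (g ∘ fsuc)       ≡⟨ cong₂ _+_ (elsewhere fzero λ ())
                                      (sum-update i d (λ k k≢i → elsewhere (fsuc k) (k≢i ∘ Fin.suc-injective)) here) ⟩
  f fzero + (sum (f ∘ fsuc) + d) ≡⟨ +-assoc (f fzero) _ d ⟨
  sum f + d                      ∎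
  where open ≡-Reasoning

sum-· : ∀ {m} (r : Vector ℕ m) q → ℕΣ.sum r · q ≡ sum (λ k → r k · q)
sum-· {zero}  r q = refl
sum-· {suc m} r q =
  trans (×-homo-+ q (r fzero) (ℕΣ.sum (r ∘ fsuc))) (cong (r fzero · q +_) (sum-· (r ∘ fsuc) q))

sumℕ-allFin : ∀ {m} (r : Vector ℕ m) → sumℕ (map r (allFin m)) ≡ ℕΣ.sum r
sumℕ-allFin r = trans (cong sumℕ (map-tabulate id r)) (go r)
  where
  go : ∀ {m} (r : Vector ℕ m) → sumℕ (tabulate r) ≡ ℕΣ.sum r
  go {zero}  r = refl
  go {suc m} r = cong (r fzero ℕ.+_) (go (r ∘ fsuc))

load : ∀ {n} → (Fin n → ℚ) → List (Fin n) → ℚ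
load p js = foldr _+_ 0ℚ (map p js)

module _ {n} (p : Fin n → ℚ) where

  load-↭ : ∀ {xs ys} → xs ↭ ys → load p xs ≡ load p ys
  load-↭ xs↭ys = foldr-commMonoid (setoid ℚ) +-0-isCommutativeMonoid (↭⇒↭ₛ (map⁺ p xs↭ys))

  load-++ : ∀ xs ys → load p (xs ++ ys) ≡ load p xs + load p ys
  load-++ []       ys = sym (+-identityˡ (load p ys))
  load-++ (x ∷ xs) ys = trans (cong (p x +_) (load-++ xs ys)) (sym (+-assoc (p x) _ _))

  load-concat : ∀ {m} (O : Fin m → List (Fin n)) → load p (concat (map O (allFin m))) ≡ sum (load p ∘ O)
  load-concat O = trans (cong (load p ∘ concat) (map-tabulate id O)) (go O)
    where
    go : ∀ {m} (O : Fin m → List (Fin n)) → load p (concat (tabulate O)) ≡ sum (load p ∘ O)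
    go {zero}  O = refl
    go {suc m} O = trans (load-++ (O fzero) _) (cong (load p (O fzero) +_) (go (O ∘ fsuc)))

module WorkFunction (P : Profile) where

  t-mono : ∀ {a b} → a ≤ℕ b → t P a ≤ t P b
  t-mono = go ∘ ℕ.≤⇒≤′
    where
    go : ∀ {a b} → a ℕ.≤′ b → t P a ≤ t P b
    go ℕ.≤′-refl       = ≤-refl
    go (ℕ.≤′-step a≤b) = ≤-trans (go a≤b) (<⇒≤ (t-incr P _))

  t-nonneg : ∀ k → 0ℚ ≤ t P k
  t-nonneg k = subst (_≤ t P k) (t-zero P) (t-mono z≤n)

  partialWork-suc-below : ∀ {M x} → x ≤ t P M → partialWork P (suc M) x ≡ partialWork P M x
  partialWork-suc-below {M} {x} x≤tM = begin
    partialWork P M x + e P M * ((x ⊓ t P (suc M)) - (x ⊓ t P M))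
      ≡⟨ cong₂ (λ u v → partialWork P M x + e P M * (u - v))
           (p≤q⇒p⊓q≡p (≤-trans x≤tM (<⇒≤ (t-incr P M)))) (p≤q⇒p⊓q≡p x≤tM) ⟩
    partialWork P M x + e P M * (x - x)  ≡⟨ cong (λ u → partialWork P M x + e P M * u) (+-inverseʳ x) ⟩
    partialWork P M x + e P M * 0ℚ       ≡⟨ cong (partialWork P M x +_) (*-zeroʳ (e P M)) ⟩
    partialWork P M x + 0ℚ               ≡⟨ +-identityʳ _ ⟩
    partialWork P M x                    ∎
    where open ≡-Reasoning

  partialWork-stable : ∀ {N M x} → x ≤ t P N → N ≤ℕ M → partialWork P M x ≡ partialWork P N x
  partialWork-stable {N} {M} {x} x≤tN N≤M = go (ℕ.≤⇒≤′ N≤M)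
    where
    go : ∀ {M} → N ℕ.≤′ M → partialWork P M x ≡ partialWork P N x
    go ℕ.≤′-refl         = refl
    go (ℕ.≤′-step N≤′M) =
      trans (partialWork-suc-below (≤-trans x≤tN (t-mono (ℕ.≤′⇒≤ N≤′M)))) (go N≤′M)

  partialWork-constant-above : ∀ N {x y} → t P N ≤ x → t P N ≤ y → partialWork P N x ≡ partialWork P N y
  partialWork-constant-above zero    tN≤x tN≤y = refl
  partialWork-constant-above (suc M) tN≤x tN≤y =
    cong₂ _+_ (partialWork-constant-above M tM≤x tM≤y)
      (cong (e P M *_) (cong₂ _-_ (trans (p≥q⇒p⊓q≡q tN≤x) (sym (p≥q⇒p⊓q≡q tN≤y)))
                                  (trans (p≥q⇒p⊓q≡q tM≤x) (sym (p≥q⇒p⊓q≡q tM≤y)))))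
    where
    tM≤x = ≤-trans (<⇒≤ (t-incr P M)) tN≤x
    tM≤y = ≤-trans (<⇒≤ (t-incr P M)) tN≤y

  partialWork-segment : ∀ M {x} → t P M ≤ x → x ≤ t P (suc M) →
                        partialWork P (suc M) x ≡ partialWork P M (t P M) + e P M * (x - t P M)
  partialWork-segment M tM≤x x≤tM+1 =
    cong₂ _+_ (partialWork-constant-above M tM≤x ≤-refl)
      (cong (e P M *_) (cong₂ _-_ (p≤q⇒p⊓q≡p x≤tM+1) (p≥q⇒p⊓q≡q tM≤x)))

  partialWork-segment-strictMono : ∀ M {x y} → t P M ≤ x → x < y → y ≤ t P (suc M) →
                                   partialWork P (suc M) x < partialWork P (suc M) y
  partialWork-segment-strictMono M tM≤x x<y y≤tM+1 =
    subst₂ _<_ (sym (partialWork-segment M tM≤x (≤-trans (<⇒≤ x<y) y≤tM+1)))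
               (sym (partialWork-segment M (≤-trans tM≤x (<⇒≤ x<y)) y≤tM+1))
      (+-monoʳ-< (partialWork P M (t P M)) (*-monoʳ-<-pos (e P M) (+-monoˡ-< (- t P M) x<y)))
    where
    instance
      e-positive : Positive (e P M)
      e-positive = positive (e-pos P M)

  partialWork-strictMono : ∀ N {x y} → 0ℚ ≤ x → x < y → y ≤ t P N → partialWork P N x < partialWork P N y
  partialWork-strictMono zero 0≤x x<y y≤t0 =
    contradiction (subst (0ℚ <_) (t-zero P) (<-≤-trans (≤-<-trans 0≤x x<y) y≤t0)) (<-irrefl refl)
  partialWork-strictMono (suc M) {x} {y} 0≤x x<y y≤tM+1 with y ≤? t P M | x ≤? t P M
  ... | yes y≤tM | _       =
    subst₂ _<_ (sym (partialWork-suc-below (≤-trans (<⇒≤ x<y) y≤tM))) (sym (partialWork-suc-below y≤tM))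
      (partialWork-strictMono M 0≤x x<y y≤tM)
  ... | no y≰tM  | no x≰tM = partialWork-segment-strictMono M (<⇒≤ (≰⇒> x≰tM)) x<y y≤tM+1
  ... | no y≰tM  | yes x≤tM = begin-strict
    partialWork P (suc M) x        ≡⟨ partialWork-suc-below x≤tM ⟩
    partialWork P M x              ≤⟨ strictMono⇒mono (λ x<tM → partialWork-strictMono M 0≤x x<tM ≤-refl) x≤tM ⟩
    partialWork P M (t P M)        ≡⟨ partialWork-suc-below {M} ≤-refl ⟨
    partialWork P (suc M) (t P M)  <⟨ partialWork-segment-strictMono M ≤-refl (≰⇒> y≰tM) y≤tM+1 ⟩
    partialWork P (suc M) y        ∎
    where open ≤-Reasoning

  partialWork≤⊓ : ∀ N {x} → 0ℚ ≤ x → partialWork P N x ≤ x ⊓ t P N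
  partialWork≤⊓ zero    0≤x = ⊓-glb 0≤x (t-nonneg 0)
  partialWork≤⊓ (suc M) {x} 0≤x = begin
    partialWork P M x + e P M * d  ≤⟨ +-mono-≤ (partialWork≤⊓ M 0≤x) e*d≤d ⟩
    x ⊓ t P M + d                  ≡⟨ solve 2 (λ a b → a :+ (b :- a) := b) refl (x ⊓ t P M) (x ⊓ t P (suc M)) ⟩
    x ⊓ t P (suc M)                ∎
    where
    open ≤-Reasoning
    d = (x ⊓ t P (suc M)) - (x ⊓ t P M)
    0≤d : 0ℚ ≤ d
    0≤d = subst (_≤ d) (+-inverseʳ (x ⊓ t P M)) (+-monoˡ-≤ (- (x ⊓ t P M)) (⊓-monoʳ-≤ x (<⇒≤ (t-incr P M))))
    e*d≤d : e P M * d ≤ d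
    e*d≤d = subst (e P M * d ≤_) (*-identityˡ d) (*-monoʳ-≤-nonNeg d {{nonNegative 0≤d}} (e-le1 P M))

  work : ℚ → ℚ
  work x = partialWork P (proj₁ (t-unbdd P x)) x

  partialWork≡work : ∀ {N x} → x ≤ t P N → partialWork P N x ≡ work x
  partialWork≡work {N} {x} x≤tN with ℕ.≤-total N (proj₁ (t-unbdd P x))
  ... | inj₁ N≤ = sym (partialWork-stable x≤tN N≤)
  ... | inj₂ ≤N = partialWork-stable (proj₂ (t-unbdd P x)) ≤N

  Work⇒≡work : ∀ {x w} → Work P x w → w ≡ work x
  Work⇒≡work (N , x≤tN , refl) = partialWork≡work x≤tN

  Work-work : ∀ x → Work P x (work x)
  Work-work x = proj₁ (t-unbdd P x) , proj₂ (t-unbdd P x) , refl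

  work-zero : work 0ℚ ≡ 0ℚ
  work-zero = sym (partialWork≡work {0} (t-nonneg 0))

  work-strictMono : ∀ {x y} → 0ℚ ≤ x → x < y → work x < work y
  work-strictMono {x} {y} 0≤x x<y =
    subst₂ _<_ (partialWork≡work (≤-trans (<⇒≤ x<y) y≤tN)) (partialWork≡work y≤tN)
      (partialWork-strictMono _ 0≤x x<y y≤tN)
    where y≤tN = proj₂ (t-unbdd P y)

  work-mono : ∀ {x y} → 0ℚ ≤ x → x ≤ y → work x ≤ work y
  work-mono 0≤x = strictMono⇒mono (work-strictMono 0≤x)

  work-nonneg : ∀ {x} → 0ℚ ≤ x → 0ℚ ≤ work x
  work-nonneg 0≤x = subst (_≤ work _) work-zero (work-mono ≤-refl 0≤x)

  work≤time : ∀ {x} → 0ℚ ≤ x → work x ≤ x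
  work≤time {x} 0≤x = subst (_≤ x) (partialWork≡work (proj₂ (t-unbdd P x)))
                        (≤-trans (partialWork≤⊓ (proj₁ (t-unbdd P x)) 0≤x) (p⊓q≤p x _))

  partialWork-surjective : ∀ N {w} → 0ℚ ≤ w → w ≤ partialWork P N (t P N) →
                           Σ ℚ λ C → 0ℚ ≤ C × C ≤ t P N × partialWork P N C ≡ w
  partialWork-surjective zero    0≤w w≤0 = 0ℚ , ≤-refl , t-nonneg 0 , ≤-antisym 0≤w w≤0
  partialWork-surjective (suc M) {w} 0≤w w≤top with w ≤? partialWork P M (t P M)
  ... | yes w≤A =
    let C , 0≤C , C≤tM , pwC≡w = partialWork-surjective M 0≤w w≤A
    in  C , 0≤C , ≤-trans C≤tM (<⇒≤ (t-incr P M)) , trans (partialWork-suc-below C≤tM) pwC≡w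
  ... | no w≰A =
    let C , tM≤C , C≤tM+1 , segment≡w = affine-solve (e-pos P M) (<⇒≤ (≰⇒> w≰A))
          (subst (w ≤_) (partialWork-segment M (<⇒≤ (t-incr P M)) ≤-refl) w≤top)
    in  C , ≤-trans (t-nonneg M) tM≤C , C≤tM+1 , trans (partialWork-segment M tM≤C C≤tM+1) segment≡w

  work-surjective : ∀ {y w} → 0ℚ ≤ y → 0ℚ ≤ w → w ≤ work y → Σ ℚ λ C → 0ℚ ≤ C × work C ≡ w
  work-surjective {y} 0≤y 0≤w w≤work-y =
    let C , 0≤C , C≤tN , pwC≡w = partialWork-surjective N 0≤w
          (≤-trans w≤work-y (subst (work y ≤_) (sym (partialWork≡work ≤-refl)) (work-mono 0≤y y≤tN)))
    in  C , 0≤C , trans (sym (partialWork≡work C≤tN)) pwC≡w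
    where
    N = proj₁ (t-unbdd P y)
    y≤tN = proj₂ (t-unbdd P y)

  completes⇒work : ∀ {s p C} → Completes P s p C → work C ≡ work s + p × s ≤ C
  completes⇒work (_ , _ , Work-s , Work-C , wc≡ws+p , s≤C , _) =
    trans (sym (Work⇒≡work Work-C)) (trans wc≡ws+p (cong (_+ _) (Work⇒≡work Work-s))) , s≤C

  work⇒completes : ∀ {s p C} → 0ℚ ≤ s → 0ℚ ≤ C → 0ℚ < p → work C ≡ work s + p → Completes P s p C
  work⇒completes {s} {p} {C} 0≤s 0≤C 0<p work-C≡ =
    work s , work C , Work-work s , Work-work C , work-C≡ , s≤C , earliest
    where
    work-s<work-C : work s < work C
    work-s<work-C = subst (work s <_) (sym work-C≡) (p<p+q (work s) 0<p)
    s≤C : s ≤ C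
    s≤C = ≮⇒≥ λ C<s → <-asym work-s<work-C (work-strictMono 0≤C C<s)
    earliest : ∀ C′ w′ → s ≤ C′ → C′ < C → Work P C′ w′ → ¬ (w′ ≡ work s + p)
    earliest C′ w′ s≤C′ C′<C Work-C′ w′≡ =
      <-irrefl (trans (sym (Work⇒≡work Work-C′)) (trans w′≡ (sym work-C≡)))
               (work-strictMono (≤-trans 0≤s s≤C′) C′<C)

  completes-by : ∀ {s p y} → 0ℚ ≤ s → 0ℚ < p → 0ℚ ≤ y → work s + p ≤ work y →
                 Σ ℚ λ C → Completes P s p C × C ≤ y
  completes-by {s} {p} {y} 0≤s 0<p 0≤y enough =
    let C , 0≤C , work-C≡ = work-surjective 0≤y (+-mono-≤ (work-nonneg 0≤s) (<⇒≤ 0<p)) enough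
    in  C , work⇒completes 0≤s 0≤C 0<p work-C≡ ,
        ≮⇒≥ (λ y<C → <-irrefl refl
               (<-≤-trans (work-strictMono 0≤y y<C) (subst (_≤ work y) (sym work-C≡) enough)))

  run-work : ∀ {n} {p : Fin n → ℚ} {s js Cs} → Run P p s js Cs → 0ℚ ≤ s →
             work (lastOr s Cs) ≡ work s + load p js × s ≤ lastOr s Cs
  run-work run-[] 0≤s = sym (+-identityʳ _) , ≤-refl
  run-work {p = p} {s} (run-∷ {j = j} {js} {C} completes rest) 0≤s =
    let work-C≡ , s≤C = completes⇒work completes
        work-last≡ , C≤last = run-work rest (≤-trans 0≤s s≤C)
    in  trans work-last≡ (trans (cong (_+ load p js) work-C≡) (+-assoc (work s) (p j) _)) , ≤-trans s≤C C≤last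

open WorkFunction using (work; work-zero; work-mono; work≤time; completes⇒work; completes-by; run-work)

makespan-nonneg : ∀ {m} (Cs : Fin m → List ℚ) → 0ℚ ≤ makespan Cs
makespan-nonneg {m} Cs = go (map (finish Cs) (allFin m))
  where
  go : ∀ xs → 0ℚ ≤ foldr _⊔_ 0ℚ xs
  go []       = ≤-refl
  go (x ∷ xs) = ≤-trans (go xs) (p≤q⊔p x _)

finish≤makespan : ∀ {m} (Cs : Fin m → List ℚ) i → finish Cs i ≤ makespan Cs
finish≤makespan Cs i =
  subst (finish Cs i ≤_) (cong (foldr _⊔_ 0ℚ) (sym (map-tabulate id (finish Cs)))) (go (finish Cs) i)
  where
  go : ∀ {m} (f : Vector ℚ m) i → f i ≤ foldr _⊔_ 0ℚ (tabulate f)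
  go f fzero    = p≤p⊔q _ _
  go f (fsuc i) = ≤-trans (go (f ∘ fsuc) i) (p≤q⊔p (f fzero) _)

load≤capacity : ∀ {m n} {prof : Fin m → Profile} {p : Fin n → ℚ} {O Cs} → Feasible prof p O Cs →
                load p (allFin n) ≤ sum (λ i → work (prof i) (makespan Cs))
load≤capacity {m} {n} {prof} {p} {O} {Cs} (O↭allFin , runs) = begin
  load p (allFin n)                          ≡⟨ load-↭ p O↭allFin ⟨
  load p (concat (map O (allFin m)))         ≡⟨ load-concat p O ⟩
  sum (load p ∘ O)                           ≤⟨ sum-mono-≤ machine-bound ⟩
  sum (λ i → work (prof i) (makespan Cs))    ∎
  where
  open ≤-Reasoning
  machine-bound : ∀ i → load p (O i) ≤ work (prof i) (makespan Cs)
  machine-bound i =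
    let work-finish≡ , 0≤finish = run-work (prof i) (runs i) ≤-refl
    in  subst (_≤ work (prof i) (makespan Cs))
          (trans work-finish≡ (trans (cong (_+ load p (O i)) (work-zero (prof i))) (+-identityˡ _)))
          (work-mono (prof i) 0≤finish (finish≤makespan Cs i))

update-≡ : ∀ {m} {A : Set} (f : Fin m → A) i g → update f i g i ≡ g (f i)
update-≡ f i g with i ≟ i
... | yes _   = refl
... | no i≢i = contradiction refl i≢i

update-≢ : ∀ {m} {A : Set} (f : Fin m → A) i g {k} → k ≢ i → update f i g k ≡ f k
update-≢ f i g {k} k≢i with k ≟ i
... | yes k≡i = contradiction k≡i k≢i
... | no _    = refl

update-preserves : ∀ {m} {A : Set} (Q : Fin m → A → Set) {f : Fin m → A} {i g} →
                   (∀ k → Q k (f k)) → Q i (g (f i)) → ∀ k → Q k (update f i g k)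
update-preserves Q {i = i} everywhere at-i k with k ≟ i
... | yes refl = at-i
... | no _     = everywhere k

lastOr-snoc : ∀ d xs (c : ℚ) → lastOr d (xs ++ [ c ]) ≡ c
lastOr-snoc d []       c = refl
lastOr-snoc d (x ∷ xs) c = lastOr-snoc x xs c

module _ (a b : ℚ) {q : ℚ} where

  slack⇒< : ∀ r → 0ℚ ≤ q → a + r · q < b + q → a < b + q
  slack⇒< r 0≤q slack = ≤-<-trans (p≤p+q a (·-nonneg r 0≤q)) slack

  slack-shrink : ∀ r {q′} → q′ ≤ q → a < b + q′ → a + r · q < b + q → a + r · q′ < b + q′
  slack-shrink zero    {q′} q′≤q a<b+q′ _     = subst (_< b + q′) (sym (+-identityʳ a)) a<b+q′
  slack-shrink (suc r) {q′} q′≤q a<b+q′ slack = begin-strict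
    a + (q′ + r · q′)  ≡⟨ x∙yz≈xz∙y a q′ (r · q′) ⟩
    (a + r · q′) + q′  ≤⟨ +-monoˡ-≤ q′ (+-monoʳ-≤ a (·-monoʳ-≤ r q′≤q)) ⟩
    (a + r · q) + q′   <⟨ +-monoˡ-< q′ a+r·q<b ⟩
    b + q′             ∎
    where
    open ≤-Reasoning
    a+r·q<b : a + r · q < b
    a+r·q<b = +-cancelʳ-< q (subst (_< b + q) (x∙yz≈xz∙y a q (r · q)) slack)

  slack-extend : ∀ r {d} → 0ℚ ≤ d → a + r · q < b + q → a + r · q < (b + d) + q
  slack-extend r {d} 0≤d slack = <-≤-trans slack (+-monoˡ-≤ q (p≤p+q b 0≤d))

  slack-late : ∀ r {d} → q ≤ d → a + r · q < b + q → a + suc r · q < (b + d) + q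
  slack-late r {d} q≤d slack = begin-strict
    a + (q + r · q)  ≡⟨ x∙yz≈xz∙y a q (r · q) ⟩
    (a + r · q) + q  <⟨ +-monoˡ-< q slack ⟩
    (b + q) + q      ≤⟨ +-monoˡ-≤ q (+-monoʳ-≤ b q≤d) ⟩
    (b + d) + q      ∎
    where open ≤-Reasoning

slack-count-bound : ∀ {m} (a b : Vector ℚ (suc m)) (r : Vector ℕ (suc m)) {q} → 0ℚ < q →
                    sum b ≤ sum a → (∀ k → a k + r k · q < b k + q) → ℕΣ.sum r ≤ℕ m
slack-count-bound {m} a b r {q} 0<q Σb≤Σa slack = ℕ.≮⇒≥ λ m<Σr → <-irrefl refl (begin-strict
  sum a + ℕΣ.sum r · q               ≡⟨ cong (sum a +_) (sum-· r q) ⟩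
  sum a + sum (λ k → r k · q)        ≡⟨ ∑-distrib-+ a (λ k → r k · q) ⟨
  sum (λ k → a k + r k · q)          <⟨ sum-mono-< slack ⟩
  sum (λ k → b k + q)                ≡⟨ ∑-distrib-+ b (λ _ → q) ⟩
  sum b + sum (replicate (suc m) q)  ≡⟨ cong (sum b +_) (sum-replicate (suc m) {q}) ⟩
  sum b + suc m · q                  ≤⟨ +-mono-≤ Σb≤Σa (·-monoˡ-≤ (<⇒≤ 0<q) m<Σr) ⟩
  sum a + ℕΣ.sum r · q               ∎)
  where open ≤-Reasoning

module ListScheduling {m n} (prof : Fin m → Profile) (p : Fin n → ℚ) (p-pos : ∀ j → 0ℚ < p j)
                      (Cstar : ℚ) (0≤Cstar : 0ℚ ≤ Cstar) where

  W : Fin m → ℚ → ℚ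
  W k = work (prof k)

  workDone : (Fin m → List ℚ) → ℚ
  workDone Cs = sum (λ k → W k (finish Cs k))

  late : List ℚ → ℕ
  late cs = length (filter (Cstar <?_) cs)

  late-++ : ∀ cs ds → late (cs ++ ds) ≡ late cs ℕ.+ late ds
  late-++ cs ds = trans (cong length (filter-++ (Cstar <?_) cs ds)) (length-++ (filter (Cstar <?_) cs))

  late-snoc-late : ∀ cs {c} → Cstar < c → late (cs ++ [ c ]) ≡ suc (late cs)
  late-snoc-late cs C*<c =
    trans (late-++ cs _) (trans (cong (λ xs → late cs ℕ.+ length xs) (filter-accept (Cstar <?_) C*<c))
                                (ℕ.+-comm (late cs) 1))

  late-snoc-early : ∀ cs {c} → ¬ Cstar < c → late (cs ++ [ c ]) ≡ late cs
  late-snoc-early cs C*≮c =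
    trans (late-++ cs _) (trans (cong (λ xs → late cs ℕ.+ length xs) (filter-reject (Cstar <?_) C*≮c))
                                (ℕ.+-identityʳ (late cs)))

  Slack : ℚ → Fin m → List ℚ → Set
  Slack q k cs = W k Cstar + late cs · q < W k (lastOr 0ℚ cs) + q

  record Invariant (Cs : Fin m → List ℚ) : Set where
    field
      q             : ℚ
      0<q           : 0ℚ < q
      finish-nonneg : ∀ k → 0ℚ ≤ finish Cs k
      slack         : ∀ k → Slack q k (Cs k)

  -- Before any job is late the slack only asks W k C* < q, and W k C* ≤ C*.
  initial-invariant : Invariant (λ _ → [])
  initial-invariant = record
    { q             = Cstar + 1ℚ
    ; 0<q           = ≤-<-trans 0≤Cstar C*<C*+1
    ; finish-nonneg = λ _ → ≤-refl
    ; slack         = initial-slack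
    }
    where
    C*<C*+1 : Cstar < Cstar + 1ℚ
    C*<C*+1 = p<p+q Cstar (positive⁻¹ 1ℚ)
    initial-slack : ∀ k → Slack (Cstar + 1ℚ) k []
    initial-slack k = begin-strict
      W k Cstar + 0ℚ         ≡⟨ +-identityʳ (W k Cstar) ⟩
      W k Cstar              ≤⟨ work≤time (prof k) 0≤Cstar ⟩
      Cstar                  <⟨ C*<C*+1 ⟩
      Cstar + 1ℚ             ≡⟨ +-identityˡ (Cstar + 1ℚ) ⟨
      0ℚ + (Cstar + 1ℚ)      ≡⟨ cong (_+ (Cstar + 1ℚ)) (work-zero (prof k)) ⟨
      W k 0ℚ + (Cstar + 1ℚ)  ∎
      where open ≤-Reasoning

  earliest-completion-bound : ∀ {Cs j C} → (∀ k → 0ℚ ≤ finish Cs k) →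
    (∀ k C′ → Completes (prof k) (finish Cs k) (p j) C′ → C ≤ C′) →
    Cstar < C → ∀ k → W k Cstar < W k (finish Cs k) + p j
  earliest-completion-bound {Cs} {j} {C} finish-nonneg earliest C*<C k
    with W k Cstar <? W k (finish Cs k) + p j
  ... | yes bound = bound
  ... | no ¬bound =
    let C′ , completes , C′≤C* = completes-by (prof k) (finish-nonneg k) (p-pos j) 0≤Cstar (≮⇒≥ ¬bound)
    in  contradiction (<-≤-trans C*<C (≤-trans (earliest k C′ completes) C′≤C*)) (<-irrefl refl)

  module _ {Cs : Fin m → List ℚ} {j : Fin n} (i : Fin m) (C : ℚ)
           (completes : Completes (prof i) (finish Cs i) (p j) C) where

    private
      Cs′ : Fin m → List ℚ
      Cs′ = update Cs i (_++ [ C ])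

      work-C≡ : W i C ≡ W i (finish Cs i) + p j
      work-C≡ = proj₁ (completes⇒work (prof i) completes)

      work-last≡ : W i (lastOr 0ℚ (Cs i ++ [ C ])) ≡ W i (finish Cs i) + p j
      work-last≡ = trans (cong (W i) (lastOr-snoc 0ℚ (Cs i) C)) work-C≡

    workDone-step : workDone Cs′ ≡ workDone Cs + p j
    workDone-step = sum-update i (p j)
      (λ k k≢i → cong (W k ∘ lastOr 0ℚ) (update-≢ Cs i (_++ [ C ]) k≢i))
      (trans (cong (W i ∘ lastOr 0ℚ) (update-≡ Cs i (_++ [ C ]))) work-last≡)

    finish-nonneg-step : (∀ k → 0ℚ ≤ finish Cs k) → ∀ k → 0ℚ ≤ finish Cs′ k
    finish-nonneg-step finish-nonneg =
      update-preserves (λ _ cs → 0ℚ ≤ lastOr 0ℚ cs) {Cs} {i} {_++ [ C ]} finish-nonneg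
        (subst (0ℚ ≤_) (sym (lastOr-snoc 0ℚ (Cs i) C))
          (≤-trans (finish-nonneg i) (proj₂ (completes⇒work (prof i) completes))))

    invariant-step-early : ¬ Cstar < C → Invariant Cs → Invariant Cs′
    invariant-step-early C*≮C I = record
      { q             = q
      ; 0<q           = 0<q
      ; finish-nonneg = finish-nonneg-step finish-nonneg
      ; slack         = update-preserves (Slack q) {Cs} {i} {_++ [ C ]} slack
                          (subst₂ (λ r b → W i Cstar + r · q < b + q)
                             (sym (late-snoc-early (Cs i) C*≮C)) (sym work-last≡)
                             (slack-extend (W i Cstar) (W i (finish Cs i)) (late (Cs i)) (<⇒≤ (p-pos j)) (slack i)))
      }
      where open Invariant I

    invariant-step-late : Cstar < C → (∀ k C′ → Completes (prof k) (finish Cs k) (p j) C′ → C ≤ C′) →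
                          Invariant Cs → Invariant Cs′
    invariant-step-late C*<C earliest I = record
      { q             = q ⊓ p j
      ; 0<q           = <-⊓ 0<q (p-pos j)
      ; finish-nonneg = finish-nonneg-step finish-nonneg
      ; slack         = update-preserves (Slack (q ⊓ p j)) {Cs} {i} {_++ [ C ]} shrunk
                          (subst₂ (λ r b → W i Cstar + r · (q ⊓ p j) < b + q ⊓ p j)
                             (sym (late-snoc-late (Cs i) C*<C)) (sym work-last≡)
                             (slack-late (W i Cstar) (W i (finish Cs i)) (late (Cs i)) (p⊓q≤q q (p j)) (shrunk i)))
      }
      where
      open Invariant I
      bound : ∀ k → W k Cstar < W k (finish Cs k) + p j
      bound = earliest-completion-bound {Cs} finish-nonneg earliest C*<C
      shrunk : ∀ k → Slack (q ⊓ p j) k (Cs k)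
      shrunk k = slack-shrink (W k Cstar) (W k (finish Cs k)) (late (Cs k)) (p⊓q≤p q (p j))
                   (subst (W k Cstar <_) (sym (mono-≤-distrib-⊓ (+-monoʳ-≤ (W k (finish Cs k))) q (p j)))
                     (<-⊓ (slack⇒< (W k Cstar) (W k (finish Cs k)) (late (Cs k)) (<⇒≤ 0<q) (slack k)) (bound k)))
                   (slack k)

    invariant-step : (∀ k C′ → Completes (prof k) (finish Cs k) (p j) C′ → C ≤ C′) →
                     Invariant Cs → Invariant Cs′
    invariant-step earliest with Cstar <? C
    ... | yes C*<C = invariant-step-late C*<C earliest
    ... | no C*≮C  = invariant-step-early C*≮C

  load-conserved : ∀ {S Cs L S′ Cs′} → LSECT prof p S Cs L S′ Cs′ → workDone Cs + load p L ≡ workDone Cs′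
  load-conserved ls-done = +-identityʳ _
  load-conserved {Cs = Cs} (ls-step {j = j} {L} i C completes _ rest) = begin
    workDone Cs + (p j + load p L)                 ≡⟨ +-assoc (workDone Cs) (p j) (load p L) ⟨
    (workDone Cs + p j) + load p L                 ≡⟨ cong (_+ load p L) (workDone-step i C completes) ⟨
    workDone (update Cs i (_++ [ C ])) + load p L  ≡⟨ load-conserved rest ⟩
    _                                              ∎
    where open ≡-Reasoning

  workDone≡load : ∀ {L S Cs} → LSECT prof p (λ _ → []) (λ _ → []) L S Cs → workDone Cs ≡ load p L
  workDone≡load {L} {Cs = Cs} run = begin
    workDone Cs                        ≡⟨ load-conserved run ⟨
    workDone (λ _ → []) + load p L     ≡⟨ cong (_+ load p L) (sum-cong-≗ (λ k → work-zero (prof k))) ⟩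
    sum (replicate m 0ℚ) + load p L    ≡⟨ cong (_+ load p L) (sum-replicate-zero m) ⟩
    0ℚ + load p L                      ≡⟨ +-identityˡ (load p L) ⟩
    load p L                           ∎
    where open ≡-Reasoning

  invariant-preserved : ∀ {S Cs L S′ Cs′} → LSECT prof p S Cs L S′ Cs′ → Invariant Cs → Invariant Cs′
  invariant-preserved ls-done                               = λ I → I
  invariant-preserved (ls-step i C completes earliest rest) =
    invariant-preserved rest ∘ invariant-step i C completes earliest

claim1 : (m n m1 : ℕ) (e0 : ℚ) → 0ℚ < e0 → e0 ≤ 1ℚ → 1 ≤ℕ m1 → m1 <ℕ m →
    (prof : Fin m → Profile) →
    (∀ i → toℕ i <ℕ m1 → ∀ k → e0 ≤ e (prof i) k) →
    (p : Fin n → ℚ) → (∀ j → 0ℚ < p j) →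
    (Cstar : ℚ) → IsOptimalMakespan prof p Cstar →
    (S : Fin m → List (Fin n)) (Cs : Fin m → List ℚ) → LSECTSchedule prof p S Cs →
    (∀ i → toℕ i <ℕ m1 → Cstar < finish Cs i) →
    lateCount m1 Cstar Cs ≤ℕ m ∸ 1
claim1 zero    _ _  _ _ _ _ ()
claim1 (suc m) n m1 _ _ _ _ _ prof _ p p-pos _ ((O , OCs , feasible , refl) , _) S Cs (L , L↭allFin , run) _ =
  subst (_≤ℕ m) (sym (sumℕ-allFin counted))
    (slack-count-bound (λ k → W k Cstar) (λ k → W k (finish Cs k)) counted 0<q work-bound counted-slack)
  where
  Cstar = makespan OCs
  open ListScheduling prof p p-pos Cstar (makespan-nonneg OCs)
  open Invariant (invariant-preserved run initial-invariant)
  counted : Fin (suc m) → ℕ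
  counted k = if does (toℕ k ℕ.<? m1) then late (Cs k) else 0
  counted≤late : ∀ k → counted k ≤ℕ late (Cs k)
  counted≤late k with does (toℕ k ℕ.<? m1)
  ... | true  = ℕ.≤-refl
  ... | false = z≤n
  counted-slack : ∀ k → W k Cstar + counted k · q < W k (finish Cs k) + q
  counted-slack k = ≤-<-trans (+-monoʳ-≤ (W k Cstar) (·-monoˡ-≤ (<⇒≤ 0<q) (counted≤late k))) (slack k)
  work-bound : workDone Cs ≤ sum (λ k → W k Cstar)
  work-bound = begin
    workDone Cs            ≡⟨ workDone≡load run ⟩
    load p L               ≡⟨ load-↭ p L↭allFin ⟩
    load p (allFin n)      ≤⟨ load≤capacity feasible ⟩
    sum (λ k → W k Cstar)  ∎
    where open ≤-Reasoning
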